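{- For every positive integer $n$, the Domineering board with $n$ rows and $n$ columns is either a first-player win or a second-player win. Moreover, for every integer $k>1$: if the $n\times n$ board is a first-player win, then the $n\times kn$ board is either a second-player win or a win for Hepzibah when $k$ is even, and is either a first-player win or a win for Hepzibah when $k$ is odd; if the $n\times n$ board is a second-player win, then the $n\times kn$ board is either a second-player win or a win for Hepzibah.
   Context: Domineering is a two-player game on a board of cells of the square lattice. Vera places vertical dominoes (covering two vertically adjacent empty cells), Hepzibah places horizontal dominoes (covering two horizontally adjacent empty cells); they alternate, and a player unable to move on her turn loses. An $m\times n$ board has $m$ rows and $n$ columns. A position is a win for Vera (resp. Hepzibah) if she wins regardless of who moves first, a first-player win if whoever moves first wins, and a second-player win if whoever moves second wins. -}

module Defs where

open import Data.Nat using (ℕ; suc; _<_; _≟_)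
open import Data.Bool using (Bool; true; false; if_then_else_; _∧_)
open import Data.Product using (_×_)
open import Relation.Binary.PropositionalEquality using (_≡_)
open import Relation.Nullary.Decidable using (⌊_⌋)

-- Players: Vera places vertical dominoes, Hepzibah horizontal ones.
data Player : Set where
  vera hepzibah : Player

other : Player → Player
other vera     = hepzibah
other hepzibah = vera

-- A position of Domineering on an m×n board (m rows, n columns):
-- S r c = true iff the cell in row r, column c is occupied.
-- Only cells with r < m and c < n belong to the board.
Position : Set
Position = ℕ → ℕ → Bool

emptyBoard : Position
emptyBoard _ _ = false

Free : ℕ → ℕ → Position → ℕ → ℕ → Set
Free m n S r c = (r < m) × (c < n) × (S r c ≡ false)

second-r : Player → ℕ → ℕ
second-r vera     r = suc r
second-r hepzibah r = r

second-c : Player → ℕ → ℕ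
second-c vera     c = c
second-c hepzibah c = suc c

Legal : ℕ → ℕ → Player → Position → ℕ → ℕ → Set
Legal m n p S r c = Free m n S r c × Free m n S (second-r p r) (second-c p c)

fill : ℕ → ℕ → Position → Position
fill r c S r' c' = if ⌊ r' ≟ r ⌋ ∧ ⌊ c' ≟ c ⌋ then true else S r' c'

place : Player → Position → ℕ → ℕ → Position
place p S r c = fill (second-r p r) (second-c p c) (fill r c S)

-- Wins m n p S : player p, to move in S, has a winning strategy.
-- Loses m n p S : player p, to move in S, loses against best play
-- (in particular if p has no legal move).
mutual
  data Wins (m n : ℕ) : Player → Position → Set where
    win : ∀ {p S} r c → Legal m n p S r c →
          Loses m n (other p) (place p S r c) → Wins m n p S

  data Loses (m n : ℕ) : Player → Position → Set where
    lose : ∀ {p S} →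
           (∀ r c → Legal m n p S r c → Wins m n (other p) (place p S r c)) →
           Loses m n p S

FirstPlayerWin : ℕ → ℕ → Set
FirstPlayerWin m n = Wins m n vera emptyBoard × Wins m n hepzibah emptyBoard

SecondPlayerWin : ℕ → ℕ → Set
SecondPlayerWin m n = Loses m n vera emptyBoard × Loses m n hepzibah emptyBoard

VeraWin : ℕ → ℕ → Set
VeraWin m n = Wins m n vera emptyBoard × Loses m n hepzibah emptyBoard

HepzibahWin : ℕ → ℕ → Set
HepzibahWin m n = Wins m n hepzibah emptyBoard × Loses m n vera emptyBoard

{-# OPTIONS --safe #-}
-- Every position is determined (induction on the number of free cells), and
-- transposing the board exchanges the two players, so the square board is never
-- a win for one player alone.
-- Vera's dominoes never cross a vertical line, so on a board cut by such a line
-- Hepzibah can answer every move of Vera in the part where it was made: if Vera,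
-- moving first, loses on both parts, she loses on the whole board. On an n×2n
-- board whose right half is the transpose of its left half, Hepzibah answers
-- each move by the transposed move in the other half, so Vera, moving first,
-- loses. The n×kn board is k/2 such boards, preceded by an n×n board when k is
-- odd, and a winning first move of Hepzibah on that n×n board wins the whole.
module Submission where

open import Defs
open import Data.Nat using (ℕ; zero; suc; _+_; _∸_; _*_; _%_; _/_; _≤_; _<_; _≟_; _<?_; z≤n)
open import Data.Nat.Properties
open import Data.Nat.DivMod using (m≡m%n+[m/n]*n)
open import Data.Nat.Induction using (<-wellFounded)
open import Data.Bool using (Bool; true; false; if_then_else_; _∧_)
import Data.Bool.Properties as Bool
open import Data.Product using (_×_; _,_; proj₁; ∃; ∃₂)
open import Data.Sum using (_⊎_; inj₁; inj₂; fromInj₁)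
open import Data.Empty using (⊥-elim)
open import Function using (_∘_)
open import Induction.WellFounded using (Acc; acc)
open import Relation.Nullary using (¬_; Dec; yes; no)
open import Relation.Nullary.Decidable using (⌊_⌋; _×-dec_)
open import Relation.Binary.PropositionalEquality

_≈_ : Position → Position → Set
S ≈ S′ = ∀ x y → S x y ≡ S′ x y

≈-sym : ∀ {S S′} → S ≈ S′ → S′ ≈ S
≈-sym S≈S′ x y = sym (S≈S′ x y)

transpose : Position → Position
transpose S x y = S y x

_⊑_ : Position → Position → Set
S ⊑ S′ = ∀ x y → S x y ≡ true → S′ x y ≡ true

fill-hit : ∀ r c S → fill r c S r c ≡ true
fill-hit r c S with r ≟ r | c ≟ c
... | yes _  | yes _  = refl
... | yes _  | no c≢c = ⊥-elim (c≢c refl)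
... | no r≢r | _      = ⊥-elim (r≢r refl)

fill-keeps : ∀ r c S → S ⊑ fill r c S
fill-keeps r c S x y occupied with x ≟ r | y ≟ c
... | yes _ | yes _ = refl
... | yes _ | no _  = occupied
... | no _  | _     = occupied

fill-miss : ∀ r c S x y → y ≢ c → fill r c S x y ≡ S x y
fill-miss r c S x y y≢c with x ≟ r | y ≟ c
... | _     | yes y≡c = ⊥-elim (y≢c y≡c)
... | yes _ | no _    = refl
... | no _  | no _    = refl

fill-cong-at : ∀ r c S S′ x y → S x y ≡ S′ x y → fill r c S x y ≡ fill r c S′ x y
fill-cong-at r c S S′ x y = cong (if ⌊ x ≟ r ⌋ ∧ ⌊ y ≟ c ⌋ then true else_)

fill-shift : ∀ a r c S R x y → S x (a + y) ≡ R x y →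
             fill r (a + c) S x (a + y) ≡ fill r c R x y
fill-shift a r c S R x y eq with x ≟ r | a + y ≟ a + c | y ≟ c
... | no _  | _        | _        = eq
... | yes _ | yes _    | yes _    = refl
... | yes _ | no _     | no _     = eq
... | yes _ | yes a+y≡ | no y≢c   = ⊥-elim (y≢c (+-cancelˡ-≡ a y c a+y≡))
... | yes _ | no a+y≢  | yes refl = ⊥-elim (a+y≢ refl)

transpose-fill : ∀ r c S → transpose (fill r c S) ≈ fill c r (transpose S)
transpose-fill r c S x y =
  cong (if_then true else S y x) (Bool.∧-comm ⌊ y ≟ r ⌋ ⌊ x ≟ c ⌋)

place-hit : ∀ p S r c → place p S r c r c ≡ true
place-hit p S r c = fill-keeps (second-r p r) (second-c p c) (fill r c S) r c (fill-hit r c S)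

place-keeps : ∀ p S r c → S ⊑ place p S r c
place-keeps p S r c x y = fill-keeps (second-r p r) (second-c p c) (fill r c S) x y ∘ fill-keeps r c S x y

place-miss : ∀ p S r c x y → y ≢ c → y ≢ second-c p c → place p S r c x y ≡ S x y
place-miss p S r c x y y≢c y≢c₂ =
  trans (fill-miss (second-r p r) (second-c p c) (fill r c S) x y y≢c₂) (fill-miss r c S x y y≢c)

place-cong-at : ∀ p S S′ r c x y → S x y ≡ S′ x y → place p S r c x y ≡ place p S′ r c x y
place-cong-at p S S′ r c x y =
  fill-cong-at (second-r p r) (second-c p c) (fill r c S) (fill r c S′) x y ∘ fill-cong-at r c S S′ x y

place-cong : ∀ p {S S′} r c → S ≈ S′ → place p S r c ≈ place p S′ r c
place-cong p {S} {S′} r c S≈S′ x y = place-cong-at p S S′ r c x y (S≈S′ x y)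

second-c-shift : ∀ p a c → second-c p (a + c) ≡ a + second-c p c
second-c-shift vera     a c = refl
second-c-shift hepzibah a c = sym (+-suc a c)

place-shift : ∀ p a r c S R x y → S x (a + y) ≡ R x y →
              place p S r (a + c) x (a + y) ≡ place p R r c x y
place-shift p a r c S R x y eq rewrite second-c-shift p a c =
  fill-shift a (second-r p r) (second-c p c) (fill r (a + c) S) (fill r c R) x y
             (fill-shift a r c S R x y eq)

transpose-fill² : ∀ r₂ c₂ r c S →
  transpose (fill r₂ c₂ (fill r c S)) ≈ fill c₂ r₂ (fill c r (transpose S))
transpose-fill² r₂ c₂ r c S x y =
  trans (transpose-fill r₂ c₂ (fill r c S) x y)
        (fill-cong-at c₂ r₂ (transpose (fill r c S)) (fill c r (transpose S)) x y
                      (transpose-fill r c S x y))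

transpose-place : ∀ p S r c → transpose (place p S r c) ≈ place (other p) (transpose S) c r
transpose-place vera     S r c = transpose-fill² (suc r) c r c S
transpose-place hepzibah S r c = transpose-fill² r (suc c) r c S

free-cong : ∀ {m n S S′ r c} → S ≈ S′ → Free m n S r c → Free m n S′ r c
free-cong {r = r} {c} S≈S′ (r<m , c<n , vacant) = r<m , c<n , trans (sym (S≈S′ r c)) vacant

legal-cong : ∀ {m n p S S′ r c} → S ≈ S′ → Legal m n p S r c → Legal m n p S′ r c
legal-cong S≈S′ (free₁ , free₂) = free-cong S≈S′ free₁ , free-cong S≈S′ free₂

mutual
  wins-cong : ∀ {m n p S S′} → S ≈ S′ → Wins m n p S → Wins m n p S′
  wins-cong {p = p} S≈S′ (win r c legal L) =
    win r c (legal-cong S≈S′ legal) (loses-cong (place-cong p r c S≈S′) L)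

  loses-cong : ∀ {m n p S S′} → S ≈ S′ → Loses m n p S → Loses m n p S′
  loses-cong {p = p} S≈S′ (lose h) = lose λ r c legal →
    wins-cong (place-cong p r c S≈S′) (h r c (legal-cong (≈-sym S≈S′) legal))

free-transpose : ∀ {m n} S {r c} → Free m n S r c → Free n m (transpose S) c r
free-transpose S (r<m , c<n , vacant) = c<n , r<m , vacant

legal-transpose : ∀ {m n} p S {r c} → Legal m n p S r c → Legal n m (other p) (transpose S) c r
legal-transpose vera     S (free₁ , free₂) = free-transpose S free₁ , free-transpose S free₂
legal-transpose hepzibah S (free₁ , free₂) = free-transpose S free₁ , free-transpose S free₂

legal-transpose⁻ : ∀ {m n} p S {r c} → Legal n m (other p) (transpose S) c r → Legal m n p S r c
legal-transpose⁻ vera     S = legal-transpose hepzibah (transpose S)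
legal-transpose⁻ hepzibah S = legal-transpose vera (transpose S)

mutual
  transpose-wins : ∀ {m n p S} → Wins m n p S → Wins n m (other p) (transpose S)
  transpose-wins {p = p} {S} (win r c legal L) =
    win c r (legal-transpose p S legal) (loses-cong (transpose-place p S r c) (transpose-loses L))

  transpose-loses : ∀ {m n p S} → Loses m n p S → Loses n m (other p) (transpose S)
  transpose-loses {p = p} {S} (lose h) = lose λ c r legal →
    wins-cong (transpose-place p S r c) (transpose-wins (h r c (legal-transpose⁻ p S legal)))

sumBelow : ℕ → (ℕ → ℕ) → ℕ
sumBelow zero    f = 0
sumBelow (suc n) f = f n + sumBelow n f

sumBelow-mono-≤ : ∀ n {f g} → (∀ i → f i ≤ g i) → sumBelow n f ≤ sumBelow n g
sumBelow-mono-≤ zero    f≤g = z≤n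
sumBelow-mono-≤ (suc n) f≤g = +-mono-≤ (f≤g n) (sumBelow-mono-≤ n f≤g)

sumBelow-mono-< : ∀ n {f g i} → (∀ j → f j ≤ g j) → i < n → f i < g i →
                  sumBelow n f < sumBelow n g
sumBelow-mono-< (suc n) f≤g i<1+n fi<gi with m<1+n⇒m<n∨m≡n i<1+n
... | inj₁ i<n  = +-mono-≤-< (f≤g n) (sumBelow-mono-< n f≤g i<n fi<gi)
... | inj₂ refl = +-mono-<-≤ fi<gi (sumBelow-mono-≤ n f≤g)

vacancy : Bool → ℕ
vacancy true  = 0
vacancy false = 1

vacancy-antitone : ∀ {b b′} → (b ≡ true → b′ ≡ true) → vacancy b′ ≤ vacancy b
vacancy-antitone {true}  b⇒b′ rewrite b⇒b′ refl = z≤n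
vacancy-antitone {false} {true}  _ = z≤n
vacancy-antitone {false} {false} _ = ≤-refl

vacancy-< : ∀ {b b′} → b ≡ false → b′ ≡ true → vacancy b′ < vacancy b
vacancy-< refl refl = ≤-refl

freeCells : ℕ → ℕ → Position → ℕ
freeCells m n S = sumBelow m λ r → sumBelow n λ c → vacancy (S r c)

freeCells-< : ∀ {m n S S′ r c} → S ⊑ S′ → Free m n S r c → S′ r c ≡ true →
              freeCells m n S′ < freeCells m n S
freeCells-< {m} {n} S⊑S′ (r<m , c<n , vacant) occupied =
  sumBelow-mono-< m (λ r → sumBelow-mono-≤ n λ c → vacancy-antitone (S⊑S′ r c)) r<m
    (sumBelow-mono-< n (λ c → vacancy-antitone (S⊑S′ _ c)) c<n (vacancy-< vacant occupied))

place-reduces : ∀ {m n p S r c} → Legal m n p S r c → freeCells m n (place p S r c) < freeCells m n S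
place-reduces {p = p} {S} {r} {c} (free , _) = freeCells-< (place-keeps p S r c) free (place-hit p S r c)

wins⇒¬loses : ∀ {m n p S} → Wins m n p S → ¬ Loses m n p S
wins⇒¬loses (win r c legal L) (lose h) = wins⇒¬loses (h r c legal) L

free? : ∀ m n S r c → Dec (Free m n S r c)
free? m n S r c = r <? m ×-dec c <? n ×-dec S r c Bool.≟ false

legal? : ∀ m n p S r c → Dec (Legal m n p S r c)
legal? m n p S r c = free? m n S r c ×-dec free? m n S (second-r p r) (second-c p c)

WinningMove : ℕ → ℕ → Player → Position → ℕ → ℕ → Set
WinningMove m n p S r c = Legal m n p S r c × Loses m n (other p) (place p S r c)

determined-step : ∀ {m n p S} →
  (∀ {r c} → Legal m n p S r c →
     Wins m n (other p) (place p S r c) ⊎ Loses m n (other p) (place p S r c)) →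
  Wins m n p S ⊎ Loses m n p S
determined-step {m} {n} {p} {S} next = decide (anyUpTo? (λ r → anyUpTo? (winningMove? r) n) m)
  where
  winningMove? : ∀ r c → Dec (WinningMove m n p S r c)
  winningMove? r c with legal? m n p S r c
  ... | no ¬legal = no (¬legal ∘ proj₁)
  ... | yes legal with next legal
  ...   | inj₁ W = no λ (_ , L) → wins⇒¬loses W L
  ...   | inj₂ L = yes (legal , L)

  decide : Dec (∃ λ r → r < m × ∃ λ c → c < n × WinningMove m n p S r c) →
           Wins m n p S ⊎ Loses m n p S
  decide (yes (r , _ , c , _ , legal , L)) = inj₁ (win r c legal L)
  decide (no ¬winning) = inj₂ (lose λ { r c legal@((r<m , c<n , _) , _) →
    fromInj₁ (λ L → ⊥-elim (¬winning (r , r<m , c , c<n , legal , L))) (next legal) })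

determined : ∀ m n p S → Wins m n p S ⊎ Loses m n p S
determined m n p S = go p S (<-wellFounded (freeCells m n S))
  where
  go : ∀ p S → Acc _<_ (freeCells m n S) → Wins m n p S ⊎ Loses m n p S
  go p S (acc rs) = determined-step λ legal → go (other p) _ (rs (place-reduces legal))

Answerable : ℕ → ℕ → (Position → Set) → Set
Answerable m n I = ∀ {S r c} → I S → Legal m n vera S r c →
  ∃₂ λ r′ c′ → Legal m n hepzibah (place vera S r c) r′ c′ ×
               I (place hepzibah (place vera S r c) r′ c′)

answerable⇒loses : ∀ {m n I} → Answerable m n I → ∀ {S} → I S → Loses m n vera S
answerable⇒loses {m} {n} {I} answer {S} = go S (<-wellFounded (freeCells m n S))
  where
  go : ∀ S → Acc _<_ (freeCells m n S) → I S → Loses m n vera S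
  go S (acc rs) inv = lose λ r c legal →
    let r′ , c′ , legal′ , inv′ = answer inv legal
    in win r′ c′ legal′ (go _ (rs (<-trans (place-reduces legal′) (place-reduces legal))) inv′)

record Juxtaposed (a : ℕ) (L R S : Position) : Set where
  field
    left  : ∀ x y → y < a → S x y ≡ L x y
    right : ∀ x y → S x (a + y) ≡ R x y
open Juxtaposed

juxtaposed-respʳ : ∀ {a L R R′ S} → R ≈ R′ → Juxtaposed a L R S → Juxtaposed a L R′ S
juxtaposed-respʳ R≈R′ J = record
  { left = left J ; right = λ x y → trans (right J x y) (R≈R′ x y) }

data Side (a : ℕ) : ℕ → Set where
  inLeft  : ∀ {c} → c < a → Side a c
  inRight : ∀ e → Side a (a + e)

side : ∀ a c → Side a c
side a c with c <? a
... | yes c<a = inLeft c<a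
... | no  c≮a = subst (Side a) (m+[n∸m]≡n (≮⇒≥ c≮a)) (inRight (c ∸ a))

<⇒≢shifted : ∀ {y a} → y < a → ∀ k → y ≢ a + k
<⇒≢shifted {a = a} y<a k = <⇒≢ (<-≤-trans y<a (m≤m+n a k))

c≤second-c : ∀ p c → c ≤ second-c p c
c≤second-c vera     c = ≤-refl
c≤second-c hepzibah c = n≤1+n c

legal-second-c< : ∀ {m n p S r c} → Legal m n p S r c → second-c p c < n
legal-second-c< (_ , (_ , second-c<n , _)) = second-c<n

module _ {a : ℕ} {L R S : Position} (J : Juxtaposed a L R S) where

  place-left : ∀ {p r c} → second-c p c < a → Juxtaposed a (place p L r c) R (place p S r c)
  place-left {p} {r} {c} second-c<a = record
    { left  = λ x y y<a → place-cong-at p S L r c x y (left J x y y<a)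
    ; right = λ x y → trans (place-miss p S r c x (a + y) (≢-sym (<⇒≢shifted c<a y))
                                                           (≢-sym (<⇒≢shifted second-c<a y)))
                            (right J x y)
    }
    where c<a = ≤-<-trans (c≤second-c p c) second-c<a

  place-right : ∀ {p r c} → Juxtaposed a L (place p R r c) (place p S r (a + c))
  place-right {p} {r} {c} = record
    { left  = λ x y y<a → trans (place-miss p S r (a + c) x y (<⇒≢shifted y<a c)
                                   (subst (y ≢_) (sym (second-c-shift p a c)) (<⇒≢shifted y<a (second-c p c))))
                                (left J x y y<a)
    ; right = λ x y → place-shift p a r c S R x y (right J x y)
    }

module _ {m a b : ℕ} {L R S : Position} (J : Juxtaposed a L R S) where

  free-toLeft : ∀ {x y} → y < a → Free m (a + b) S x y → Free m a L x y
  free-toLeft y<a (x<m , _ , vacant) = x<m , y<a , trans (sym (left J _ _ y<a)) vacant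

  free-fromLeft : ∀ {x y} → Free m a L x y → Free m (a + b) S x y
  free-fromLeft (x<m , y<a , vacant) = x<m , <-≤-trans y<a (m≤m+n a b) , trans (left J _ _ y<a) vacant

  free-toRight : ∀ {x y} → Free m (a + b) S x (a + y) → Free m b R x y
  free-toRight {x} {y} (x<m , a+y<a+b , vacant) =
    x<m , +-cancelˡ-< a y b a+y<a+b , trans (sym (right J x y)) vacant

  free-fromRight : ∀ {x y} → Free m b R x y → Free m (a + b) S x (a + y)
  free-fromRight {x} {y} (x<m , y<b , vacant) = x<m , +-monoʳ-< a y<b , trans (right J x y) vacant

  legal-toLeft : ∀ {p r c} → second-c p c < a → Legal m (a + b) p S r c → Legal m a p L r c
  legal-toLeft {p} {c = c} second-c<a (free₁ , free₂) =
    free-toLeft (≤-<-trans (c≤second-c p c) second-c<a) free₁ , free-toLeft second-c<a free₂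

  legal-fromLeft : ∀ {p r c} → Legal m a p L r c → Legal m (a + b) p S r c
  legal-fromLeft (free₁ , free₂) = free-fromLeft free₁ , free-fromLeft free₂

  legal-toRight : ∀ {p r c} → Legal m (a + b) p S r (a + c) → Legal m b p R r c
  legal-toRight {p} {r} {c} (free₁ , free₂) =
    free-toRight free₁ ,
    free-toRight (subst (Free m (a + b) S (second-r p r)) (second-c-shift p a c) free₂)

  legal-fromRight : ∀ {p r c} → Legal m b p R r c → Legal m (a + b) p S r (a + c)
  legal-fromRight {p} {r} {c} (free₁ , free₂) =
    free-fromRight free₁ ,
    subst (Free m (a + b) S (second-r p r)) (sym (second-c-shift p a c)) (free-fromRight free₂)

  lift-left : ∀ {p} → Wins m a p L →
    ∃₂ λ r c → Legal m (a + b) p S r c ×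
               ∃ λ L′ → Loses m a (other p) L′ × Juxtaposed a L′ R (place p S r c)
  lift-left (win r c legal L′) =
    r , c , legal-fromLeft legal , _ , L′ , place-left J (legal-second-c< {S = L} legal)

  lift-right : ∀ {p} → Wins m b p R →
    ∃₂ λ r c → Legal m (a + b) p S r c ×
               ∃ λ R′ → Loses m b (other p) R′ × Juxtaposed a L R′ (place p S r c)
  lift-right (win r c legal R′) = r , a + c , legal-fromRight legal , _ , R′ , place-right J

LosingParts : ℕ → ℕ → ℕ → Position → Set
LosingParts m a b S = ∃₂ λ L R → Loses m a vera L × Loses m b vera R × Juxtaposed a L R S

losingParts-answerable : ∀ {m a b} → Answerable m (a + b) (LosingParts m a b)
losingParts-answerable {a = a} {c = c} (L , R , lose hL , lose hR , J) legal with side a c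
... | inLeft c<a =
  let r′ , c′ , legal′ , L′ , L′-loses , J′ =
        lift-left (place-left J c<a) (hL _ c (legal-toLeft J c<a legal))
  in  r′ , c′ , legal′ , L′ , R , L′-loses , lose hR , J′
... | inRight e =
  let r′ , c′ , legal′ , R′ , R′-loses , J′ =
        lift-right (place-right J) (hR _ e (legal-toRight J legal))
  in  r′ , c′ , legal′ , L , R′ , lose hL , R′-loses , J′

juxtapose-loses : ∀ {m a b L R S} → Loses m a vera L → Loses m b vera R → Juxtaposed a L R S →
                  Loses m (a + b) vera S
juxtapose-loses L-loses R-loses J = answerable⇒loses losingParts-answerable (_ , _ , L-loses , R-loses , J)

juxtapose-wins : ∀ {m a b L R S} → Wins m a hepzibah L → Loses m b vera R → Juxtaposed a L R S →
                 Wins m (a + b) hepzibah S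
juxtapose-wins L-wins R-loses J =
  let r , c , legal , L′ , L′-loses , J′ = lift-left J L-wins
  in  win r c legal (juxtapose-loses L′-loses R-loses J′)

Mirrored : ℕ → Position → Set
Mirrored n S = ∃ λ L → Juxtaposed n L (transpose L) S

mirrored-answerable : ∀ {n} → Answerable n (n + n) (Mirrored n)
mirrored-answerable {n} {r = r} {c} (L , J) legal with side n c
... | inLeft c<n =
  c , n + r , legal-fromRight J₁ (legal-transpose vera L (legal-toLeft J c<n legal)) ,
  _ , juxtaposed-respʳ (≈-sym (transpose-place vera L r c)) (place-right J₁)
  where J₁ = place-left J c<n
... | inRight e =
  e , r , legal-fromLeft J₁ legalL ,
  _ , juxtaposed-respʳ (≈-sym (transpose-place hepzibah L e r))
                       (place-left J₁ (legal-second-c< {S = L} legalL))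
  where
  J₁ = place-right J
  legalL : Legal n n hepzibah L e r
  legalL = legal-transpose vera (transpose L) (legal-toRight J legal)

mirror-loses : ∀ {n L S} → Juxtaposed n L (transpose L) S → Loses n (n + n) vera S
mirror-loses J = answerable⇒loses mirrored-answerable (_ , J)

empty-juxtaposed : ∀ a → Juxtaposed a emptyBoard emptyBoard emptyBoard
empty-juxtaposed a = record { left = λ _ _ _ → refl ; right = λ _ _ → refl }

vera-loses-repeated : ∀ {m a} → Loses m a vera emptyBoard → ∀ k → Loses m (k * a) vera emptyBoard
vera-loses-repeated _      zero    = lose λ { _ _ ((_ , () , _) , _) }
vera-loses-repeated {a = a} L-loses (suc k) =
  juxtapose-loses L-loses (vera-loses-repeated L-loses k) (empty-juxtaposed a)

vera-loses-doubled : ∀ n → Loses n (n + n) vera emptyBoard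
vera-loses-doubled n = mirror-loses (empty-juxtaposed n)

k*n≡[k%2]*n+[k/2]*[n+n] : ∀ k n → k * n ≡ k % 2 * n + k / 2 * (n + n)
k*n≡[k%2]*n+[k/2]*[n+n] k n = begin
  k * n                         ≡⟨ cong (_* n) (m≡m%n+[m/n]*n k 2) ⟩
  (k % 2 + k / 2 * 2) * n       ≡⟨ *-distribʳ-+ n (k % 2) (k / 2 * 2) ⟩
  k % 2 * n + k / 2 * 2 * n     ≡⟨ cong (k % 2 * n +_) (*-assoc (k / 2) 2 n) ⟩
  k % 2 * n + k / 2 * (2 * n)   ≡⟨ cong (λ t → k % 2 * n + k / 2 * (n + t)) (+-identityʳ n) ⟩
  k % 2 * n + k / 2 * (n + n)   ∎
  where open ≡-Reasoning

vera-loses-even : ∀ n k → k % 2 ≡ 0 → Loses n (k * n) vera emptyBoard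
vera-loses-even n k even rewrite k*n≡[k%2]*n+[k/2]*[n+n] k n | even =
  vera-loses-repeated (vera-loses-doubled n) (k / 2)

hepzibah-wins-odd : ∀ n k → k % 2 ≡ 1 → Wins n n hepzibah emptyBoard →
                    Wins n (k * n) hepzibah emptyBoard
hepzibah-wins-odd n k odd W rewrite k*n≡[k%2]*n+[k/2]*[n+n] k n | odd | *-identityˡ n =
  juxtapose-wins W (vera-loses-repeated (vera-loses-doubled n) (k / 2)) (empty-juxtaposed n)

vera-loses⇒second⊎hepzibah : ∀ {m n} → Loses m n vera emptyBoard →
                             SecondPlayerWin m n ⊎ HepzibahWin m n
vera-loses⇒second⊎hepzibah {m} {n} V with determined m n hepzibah emptyBoard
... | inj₁ H = inj₂ (H , V)
... | inj₂ H = inj₁ (V , H)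

hepzibah-wins⇒first⊎hepzibah : ∀ {m n} → Wins m n hepzibah emptyBoard →
                               FirstPlayerWin m n ⊎ HepzibahWin m n
hepzibah-wins⇒first⊎hepzibah {m} {n} H with determined m n vera emptyBoard
... | inj₁ V = inj₁ (V , H)
... | inj₂ V = inj₂ (H , V)

square-first⊎second : ∀ n → FirstPlayerWin n n ⊎ SecondPlayerWin n n
square-first⊎second n with determined n n vera emptyBoard
... | inj₁ V = inj₁ (V , transpose-wins V)
... | inj₂ V = inj₂ (V , transpose-loses V)

mainTheorem11 : (n : ℕ) → 0 < n →
    (FirstPlayerWin n n ⊎ SecondPlayerWin n n) ×
    ((k : ℕ) → 1 < k →
      (FirstPlayerWin n n →
        (k % 2 ≡ 0 → SecondPlayerWin n (k * n) ⊎ HepzibahWin n (k * n)) ×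
        (k % 2 ≡ 1 → FirstPlayerWin n (k * n) ⊎ HepzibahWin n (k * n))) ×
      (SecondPlayerWin n n → SecondPlayerWin n (k * n) ⊎ HepzibahWin n (k * n)))
mainTheorem11 n _ = square-first⊎second n , λ k _ →
  (λ (_ , H) → (λ even → vera-loses⇒second⊎hepzibah (vera-loses-even n k even))
             , (λ odd → hepzibah-wins⇒first⊎hepzibah (hepzibah-wins-odd n k odd H))) ,
  (λ (V , _) → vera-loses⇒second⊎hepzibah (vera-loses-repeated V k))
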